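{- Let $\omega=\omega_1\cdots\omega_\ell$ be a word with word--graph $G_\omega$. Then $\lambda(G_\omega)>1$ if and only if $\omega$ cannot be written as a concatenation $\omega=p_1p_2\cdots p_k$ of $k\ge 2$ nonempty contiguous factors whose alphabets are pairwise disjoint (i.e. $A(p_i)\cap A(p_j)=\varnothing$ for all $i\neq j$).
   Context: For a word $\omega$, $A(\omega)$ denotes the set of distinct letters occurring in $\omega$. A factor of $\omega$ is a contiguous subword $\omega_j\cdots\omega_k$. The word--graph $G_\omega$ is the simple directed graph with vertex set $A(\omega)$ and directed edge set $\{(\omega_i,\omega_{i+1}) : 1\le i\le \ell-1,\ \omega_i\neq\omega_{i+1}\}$. The edge--connectivity $\lambda(G_\omega)$ is the cardinality of a smallest set of edges of $G_\omega$ whose removal disconnects $G_\omega$. -}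

module Defs where

open import Data.Nat using (ℕ; _≤_; _<_)
open import Data.List using (List; []; _∷_; _++_; length; concat)
open import Data.List.Membership.Propositional using (_∈_; _∉_)
open import Data.List.Relation.Unary.All using (All)
open import Data.List.Relation.Unary.AllPairs using (AllPairs)
open import Data.List.Relation.Unary.Unique.Propositional using (Unique)
open import Data.Product using (Σ; ∃; ∃-syntax; _×_; _,_)
open import Relation.Binary.PropositionalEquality using (_≡_; _≢_)
open import Relation.Nullary using (¬_)

module _ {A : Set} where

  -- The letter x occurs in ω iff x ∈ ω; so A(ω) = { x | x ∈ ω }.

  IsEdge : List A → A × A → Set
  IsEdge ω (x , y) = x ≢ y × ∃[ p ] ∃[ s ] (ω ≡ p ++ (x ∷ y ∷ s))

  EdgeMinus : List A → List (A × A) → A → A → Set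
  EdgeMinus ω S x y = IsEdge ω (x , y) × (x , y) ∉ S

  -- (Weak) connectivity: a path ignoring edge orientation.
  data Path (E : A → A → Set) : A → A → Set where
    here : ∀ {x} → Path E x x
    fwd  : ∀ {x y z} → E x y → Path E y z → Path E x z
    bwd  : ∀ {x y z} → E y x → Path E y z → Path E x z

  ConnectedMinus : List A → List (A × A) → Set
  ConnectedMinus ω S = ∀ x y → x ∈ ω → y ∈ ω → Path (EdgeMinus ω S) x y

  DisconnectingSet : List A → List (A × A) → Set
  DisconnectingSet ω S = Unique S × All (IsEdge ω) S × ¬ ConnectedMinus ω S

  -- λ(G_ω) > 1 : every disconnecting edge set has cardinality > 1
  -- (λ is the minimum of these cardinalities; if none exists λ = ∞ > 1).
  EdgeConnGT1 : List A → Set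
  EdgeConnGT1 ω = ∀ S → DisconnectingSet ω S → 1 < length S

  NonEmpty : List A → Set
  NonEmpty p = p ≢ []

  Disjoint : List A → List A → Set
  Disjoint p q = ∀ a → a ∈ p → a ∉ q

  DisjointFactorization : List A → Set
  DisjointFactorization ω =
    Σ (List (List A)) λ ps →
      2 ≤ length ps × All NonEmpty ps × AllPairs Disjoint ps × concat ps ≡ ω

-- A factorization into k ≥ 2 blocks with pairwise disjoint alphabets exists iff one with
-- exactly two blocks P Q does. For such a split, the letters of P are closed under every
-- edge of G_ω except the single edge from the last letter of P to the first letter of Q,
-- so that one edge disconnects G_ω. Conversely, consecutive letters of ω are equal, joined
-- by a surviving edge, or joined by a removed one. If removing nothing disconnected G_ω,
-- every letter would be joined to the first one. If removing the single edge (x , y)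
-- disconnects G_ω, every letter is joined to x or to y but not both; reading ω from the
-- left, once a letter is joined to y all later ones are, so ω splits into a prefix
-- joined to x and a suffix joined to y with disjoint alphabets. This direction uses excluded
-- middle under a double negation, which suffices because its conclusion is a negation.
module Submission where

open import Defs
open import Data.Empty using (⊥-elim)
open import Data.List using (List; []; _∷_; _++_; _∷ʳ_; concat; initLast; _∷ʳ′_)
open import Data.List.Membership.Propositional using (_∈_; lose)
open import Data.List.Membership.Propositional.Properties using (∈-++⁺ˡ; ∈-++⁺ʳ; ∈-++⁻; ∈-concat⁻)
open import Data.List.Properties using (∷-injective; ∷ʳ-injectiveʳ; ++-identityʳ; ++-assoc)
open import Data.List.Relation.Unary.All as All using (All; []; _∷_)
open import Data.List.Relation.Unary.AllPairs using ([]; _∷_)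
open import Data.List.Relation.Unary.Any using (Any; here; there)
open import Data.List.Relation.Unary.Linked using (Linked; []; [-]; _∷_) renaming (tail to linked-tail)
open import Data.Nat using (s≤s; z≤n)
open import Data.Nat.Properties using (<-irrefl)
open import Data.Product using (∃-syntax; _×_; _,_; proj₁; proj₂)
open import Data.Sum using (_⊎_; inj₁; inj₂)
open import Function using (_∘_)
open import Function.Bundles using (_⇔_; mk⇔)
open import Relation.Binary.PropositionalEquality using (_≡_; _≢_; refl; sym; trans; cong)
open import Relation.Nullary using (¬_; yes; no)
open import Relation.Nullary.Decidable using (¬¬-excluded-middle)

module _ {A : Set} where

  path-trans : ∀ {E : A → A → Set} {a b c} → Path E a b → Path E b c → Path E a c
  path-trans here q = q
  path-trans (fwd e p) q = fwd e (path-trans p q)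
  path-trans (bwd e p) q = bwd e (path-trans p q)

  path-sym : ∀ {E : A → A → Set} {a b} → Path E a b → Path E b a
  path-sym here = here
  path-sym (fwd e p) = path-trans (path-sym p) (bwd e here)
  path-sym (bwd e p) = path-trans (path-sym p) (fwd e here)

  path-preserves : ∀ {E : A → A → Set} {C : A → Set} →
                   (∀ {a b} → E a b → C a → C b) → (∀ {a b} → E a b → C b → C a) →
                   ∀ {a b} → Path E a b → C a → C b
  path-preserves f g here c = c
  path-preserves f g (fwd e p) c = path-preserves f g p (f e c)
  path-preserves f g (bwd e p) c = path-preserves f g p (g e c)

  connected-through-hub : ∀ {ω S h} → All (λ a → Path (EdgeMinus ω S) a h) ω → ConnectedMinus ω S
  connected-through-hub paths x y x∈ω y∈ω =
    path-trans (All.lookup paths x∈ω) (path-sym (All.lookup paths y∈ω))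

  edge-endpoints-∈ : ∀ {ω : List A} {x y} → IsEdge ω (x , y) → x ∈ ω × y ∈ ω
  edge-endpoints-∈ (_ , p , s , refl) = ∈-++⁺ʳ p (here refl) , ∈-++⁺ʳ p (there (here refl))

  ∈⇒nonEmpty : ∀ {a : A} {w} → a ∈ w → NonEmpty w
  ∈⇒nonEmpty (here _) ()
  ∈⇒nonEmpty (there _) ()

  adjacent-in-++ : ∀ (P Q u v : List A) {a b} → P ++ Q ≡ u ++ a ∷ b ∷ v →
                   (a ∈ P × b ∈ P) ⊎ (a ∈ Q × b ∈ Q) ⊎ (P ≡ u ∷ʳ a × Q ≡ b ∷ v)
  adjacent-in-++ [] Q u v refl = inj₂ (inj₁ (∈-++⁺ʳ u (here refl) , ∈-++⁺ʳ u (there (here refl))))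
  adjacent-in-++ (c ∷ []) Q [] v refl = inj₂ (inj₂ (refl , refl))
  adjacent-in-++ (c ∷ d ∷ P) Q [] v refl = inj₁ (here refl , there (here refl))
  adjacent-in-++ (c ∷ P) Q (u₀ ∷ u) v eq
    with refl , eq′ ← ∷-injective eq | adjacent-in-++ P Q u v eq′
  ... | inj₁ (a∈P , b∈P) = inj₁ (there a∈P , there b∈P)
  ... | inj₂ (inj₁ inQ) = inj₂ (inj₁ inQ)
  ... | inj₂ (inj₂ (refl , Q≡)) = inj₂ (inj₂ (refl , Q≡))

  disjoint-concat : ∀ {P : List A} (qs : List (List A)) → All (Disjoint P) qs → Disjoint P (concat qs)
  disjoint-concat qs disjoints a a∈P a∈concat
    with disjoint , a∈q ← All.lookupAny disjoints (∈-concat⁻ qs a∈concat) = disjoint a a∈P a∈q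

  DisjointSplit : List A → Set
  DisjointSplit ω = ∃[ P ] ∃[ Q ] (NonEmpty P × NonEmpty Q × Disjoint P Q × P ++ Q ≡ ω)

  factorization⇒split : ∀ {ω} → DisjointFactorization ω → DisjointSplit ω
  factorization⇒split (_ ∷ [] , s≤s () , _)
  factorization⇒split (_ ∷ [] ∷ _ , _ , _ ∷ ne[] ∷ _ , _) = ⊥-elim (ne[] refl)
  factorization⇒split (P ∷ (y ∷ q) ∷ qs , _ , neP ∷ _ , (disjoints ∷ _) , refl) =
    P , concat ((y ∷ q) ∷ qs) , neP , (λ ()) , disjoint-concat ((y ∷ q) ∷ qs) disjoints , refl

  split⇒factorization : ∀ {ω} → DisjointSplit ω → DisjointFactorization ω
  split⇒factorization (P , Q , neP , neQ , disjoint , P++Q≡ω) =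
    P ∷ Q ∷ [] , s≤s (s≤s z≤n) , neP ∷ neQ ∷ [] , (disjoint ∷ []) ∷ [] ∷ [] ,
    trans (cong (P ++_) (++-identityʳ Q)) P++Q≡ω

  boundary-edge-disconnects : ∀ p x y q → Disjoint (p ∷ʳ x) (y ∷ q) →
                              DisconnectingSet ((p ∷ʳ x) ++ (y ∷ q)) ((x , y) ∷ [])
  boundary-edge-disconnects p x y q disjoint =
    ([] ∷ []) , (x≢y , p , q , ++-assoc p (x ∷ []) (y ∷ q)) ∷ [] , disconnected
    where
    ω = (p ∷ʳ x) ++ (y ∷ q)
    P = p ∷ʳ x
    E = EdgeMinus ω ((x , y) ∷ [])

    x∈P : x ∈ P
    x∈P = ∈-++⁺ʳ p (here refl)

    x≢y : x ≢ y
    x≢y refl = disjoint x x∈P (here refl)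

    stays-in-P : ∀ {a b} → E a b → (a ∈ P → b ∈ P) × (b ∈ P → a ∈ P)
    stays-in-P ((_ , u , v , eq) , removed∉S) with adjacent-in-++ P (y ∷ q) u v eq
    ... | inj₁ (a∈P , b∈P) = (λ _ → b∈P) , (λ _ → a∈P)
    ... | inj₂ (inj₁ (a∈Q , b∈Q)) = (λ a∈P → ⊥-elim (disjoint _ a∈P a∈Q)) , (λ b∈P → ⊥-elim (disjoint _ b∈P b∈Q))
    ... | inj₂ (inj₂ (P≡ , refl)) with refl ← ∷ʳ-injectiveʳ p u P≡ = ⊥-elim (removed∉S (here refl))

    disconnected : ¬ ConnectedMinus ω ((x , y) ∷ [])
    disconnected connected =
      disjoint y (path-preserves (proj₁ ∘ stays-in-P) (proj₂ ∘ stays-in-P)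
                   (connected x y (∈-++⁺ˡ x∈P) (∈-++⁺ʳ P (here refl))) x∈P) (here refl)

  split⇒¬edgeConnGT1 : ∀ {ω} → DisjointSplit ω → ¬ EdgeConnGT1 ω
  split⇒¬edgeConnGT1 (P , Q , neP , neQ , disjoint , refl) gt with initLast P | Q
  ... | [] | _ = neP refl
  ... | _ | [] = neQ refl
  ... | p ∷ʳ′ x | y ∷ q = <-irrefl refl (gt _ (boundary-edge-disconnects p x y q disjoint))

  linked-propagate : ∀ {R : A → A → Set} {C : A → Set} → (∀ {a b} → R a b → C a → C b) →
                     ∀ {a w} → Linked R (a ∷ w) → C a → All C (a ∷ w)
  linked-propagate forward [-] c = c ∷ []
  linked-propagate forward (r ∷ rs) c = c ∷ linked-propagate forward rs (forward r c)

  linked-any⇒all : ∀ {R : A → A → Set} {C : A → Set} →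
                   (∀ {a b} → R a b → C a → C b) → (∀ {a b} → R a b → C b → C a) →
                   ∀ {w} → Linked R w → Any C w → All C w
  linked-any⇒all forward backward rs (here c) = linked-propagate forward rs c
  linked-any⇒all forward backward (r ∷ rs) (there c)
    with all@(c′ ∷ _) ← linked-any⇒all forward backward rs c = backward r c′ ∷ all

  linked-span : ∀ {R : A → A → Set} {C D : A → Set} → (∀ {a b} → R a b → D a → D b) →
                ∀ {w} → Linked R w → All (λ a → C a ⊎ D a) w →
                ∃[ u ] ∃[ v ] (u ++ v ≡ w × All C u × All D v)
  linked-span forward [] [] = [] , [] , refl , [] , []
  linked-span forward rs (inj₂ d ∷ _) = [] , _ , refl , [] , linked-propagate forward rs d
  linked-span forward rs (inj₁ c ∷ cds)
    with u , v , refl , cs , ds ← linked-span forward (linked-tail rs) cds = _ ∷ u , v , refl , c ∷ cs , ds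

  Step : List A → List (A × A) → A → A → Set
  Step ω S a b = a ≡ b ⊎ EdgeMinus ω S a b ⊎ (a , b) ∈ S

  adjacent-step : ∀ {ω S} pre {a b} w → ω ≡ pre ++ a ∷ b ∷ w → ¬ ¬ Step ω S a b
  adjacent-step {S = S} pre {a} {b} w eq k = ¬¬-excluded-middle λ
    { (yes a≡b) → k (inj₁ a≡b)
    ; (no a≢b) → ¬¬-excluded-middle λ
        { (yes removed) → k (inj₂ (inj₂ removed))
        ; (no kept) → k (inj₂ (inj₁ ((a≢b , pre , w , eq) , kept))) } }

  suffix-linked : ∀ {ω S} pre w → ω ≡ pre ++ w → ¬ ¬ Linked (Step ω S) w
  suffix-linked pre [] _ k = k []
  suffix-linked pre (a ∷ []) _ k = k [-]
  suffix-linked pre (a ∷ b ∷ w) eq k =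
    suffix-linked (pre ∷ʳ a) (b ∷ w) (trans eq (sym (++-assoc pre (a ∷ []) (b ∷ w)))) λ linked →
    adjacent-step pre w eq λ step → k (step ∷ linked)

  no-removal-connected : ∀ ω → ¬ ¬ ConnectedMinus ω []
  no-removal-connected [] k = k (λ _ _ ())
  no-removal-connected (h ∷ w) k =
    suffix-linked [] (h ∷ w) refl λ linked → k (connected-through-hub (linked-propagate towards-h linked here))
    where
    towards-h : ∀ {a b} → Step (h ∷ w) [] a b → Path (EdgeMinus (h ∷ w) []) a h → Path (EdgeMinus (h ∷ w) []) b h
    towards-h (inj₁ refl) p = p
    towards-h (inj₂ (inj₁ e)) p = bwd e p
    towards-h (inj₂ (inj₂ ()))

  single-edge-cut⇒split : ∀ ω x y → x ∈ ω → y ∈ ω → ¬ ConnectedMinus ω ((x , y) ∷ []) → ¬ ¬ DisjointSplit ω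
  single-edge-cut⇒split ω x y x∈ω y∈ω disconnected k =
    suffix-linked [] ω refl λ linked →
    let joined = linked-any⇒all to-x-or-y from-x-or-y linked (lose x∈ω (inj₁ here))
        u , v , u++v≡ω , u~x , v~y = linked-span to-y linked joined
        x≁y = x≁y-of joined
    in k (u , v , nonempty-u x≁y u++v≡ω v~y , nonempty-v x≁y u++v≡ω u~x ,
          (λ a a∈u a∈v → x≁y (path-trans (path-sym (All.lookup u~x a∈u)) (All.lookup v~y a∈v))) ,
          u++v≡ω)
    where
    S = (x , y) ∷ []
    _~_ : A → A → Set
    a ~ b = Path (EdgeMinus ω S) a b

    to-x-or-y : ∀ {a b} → Step ω S a b → a ~ x ⊎ a ~ y → b ~ x ⊎ b ~ y
    to-x-or-y (inj₁ refl) joined = joined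
    to-x-or-y (inj₂ (inj₁ e)) (inj₁ p) = inj₁ (bwd e p)
    to-x-or-y (inj₂ (inj₁ e)) (inj₂ p) = inj₂ (bwd e p)
    to-x-or-y (inj₂ (inj₂ (here refl))) _ = inj₂ here

    from-x-or-y : ∀ {a b} → Step ω S a b → b ~ x ⊎ b ~ y → a ~ x ⊎ a ~ y
    from-x-or-y (inj₁ refl) joined = joined
    from-x-or-y (inj₂ (inj₁ e)) (inj₁ p) = inj₁ (fwd e p)
    from-x-or-y (inj₂ (inj₁ e)) (inj₂ p) = inj₂ (fwd e p)
    from-x-or-y (inj₂ (inj₂ (here refl))) _ = inj₁ here

    to-y : ∀ {a b} → Step ω S a b → a ~ y → b ~ y
    to-y (inj₁ refl) p = p
    to-y (inj₂ (inj₁ e)) p = bwd e p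
    to-y (inj₂ (inj₂ (here refl))) _ = here

    x≁y-of : All (λ a → a ~ x ⊎ a ~ y) ω → ¬ x ~ y
    x≁y-of joined x~y = disconnected (connected-through-hub (All.map to-x joined))
      where
      to-x : ∀ {a} → a ~ x ⊎ a ~ y → a ~ x
      to-x (inj₁ p) = p
      to-x (inj₂ p) = path-trans p (path-sym x~y)

    nonempty-u : ∀ {u v} → ¬ x ~ y → u ++ v ≡ ω → All (_~ y) v → NonEmpty u
    nonempty-u {u} x≁y refl v~y with ∈-++⁻ u x∈ω
    ... | inj₁ x∈u = ∈⇒nonEmpty x∈u
    ... | inj₂ x∈v = ⊥-elim (x≁y (All.lookup v~y x∈v))

    nonempty-v : ∀ {u v} → ¬ x ~ y → u ++ v ≡ ω → All (_~ x) u → NonEmpty v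
    nonempty-v {u} x≁y refl u~x with ∈-++⁻ u y∈ω
    ... | inj₁ y∈u = ⊥-elim (x≁y (path-sym (All.lookup u~x y∈u)))
    ... | inj₂ y∈v = ∈⇒nonEmpty y∈v

  ¬split⇒edgeConnGT1 : ∀ {ω} → ¬ DisjointSplit ω → EdgeConnGT1 ω
  ¬split⇒edgeConnGT1 {ω} ¬split [] (_ , _ , disconnected) = ⊥-elim (no-removal-connected ω disconnected)
  ¬split⇒edgeConnGT1 {ω} ¬split ((x , y) ∷ []) (_ , edge ∷ [] , disconnected)
    with x∈ω , y∈ω ← edge-endpoints-∈ edge = ⊥-elim (single-edge-cut⇒split ω x y x∈ω y∈ω disconnected ¬split)
  ¬split⇒edgeConnGT1 _ (_ ∷ _ ∷ _) _ = s≤s (s≤s z≤n)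

lemma2 : {A : Set} (ω : List A) → EdgeConnGT1 ω ⇔ (¬ DisjointFactorization ω)
lemma2 ω = mk⇔ (λ gt factorization → split⇒¬edgeConnGT1 (factorization⇒split factorization) gt)
               (λ ¬factorization → ¬split⇒edgeConnGT1 (¬factorization ∘ split⇒factorization))
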